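{- Let $L = (a_0, a_1, a_2)$ be a \textsc{Rotisserie Nim} position with three heaps and $a_0 > 1$. Then $L \in \mathcal{P}$ if and only if $a_1 > 1$ and $a_2 = 1$.
   Context: \textsc{Rotisserie Nim} is an impartial combinatorial game played under normal play (a player unable to move loses). A position is a finite list $L = (a_0, a_1, \ldots, a_n)$ of positive integers (a queue of heaps, $a_0$ at the front); the empty list is terminal. The options of $L$ are $(a_1, \ldots, a_n)$ and $(a_1, \ldots, a_n, b)$ for every integer $b$ with $1 \leq b < a_0$. $\mathcal{N}$ denotes the positions from which the next player to move wins, $\mathcal{P}$ those from which the previous player wins. -}

module Defs where

open import Data.Nat using (ℕ; suc; _<_; _≤_)
open import Data.List using (List; []; _∷_; _++_; [_])

-- A Rotisserie Nim position: a queue of heaps (front first).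
-- Heap sizes are intended to be positive; positivity is imposed in the statement.
Position : Set
Position = List ℕ

data Move : Position → Position → Set where
  remove : ∀ a as → Move (a ∷ as) as
  rotate : ∀ a as b → 1 ≤ b → b < a → Move (a ∷ as) (as ++ [ b ])

-- Outcome classes under normal play, defined inductively
-- (the game is finite, so every position is in exactly one).
mutual
  data IsN : Position → Set where
    winMove : ∀ {L L'} → Move L L' → IsP L' → IsN L

  data IsP : Position → Set where
    allLose : ∀ {L} → (∀ {L'} → Move L L' → IsN L') → IsP L

module Submission where

open import Defs
open import Data.Nat using (ℕ; _<_; _≤_; s≤s; z≤n)
open import Data.Nat.Properties using (≤-refl; m≤n⇒m<n∨m≡n)
open import Data.List using ([]; _∷_)
open import Data.Product using (_×_; _,_)
open import Data.Sum using (inj₁; inj₂)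
open import Data.Empty using (⊥-elim)
open import Relation.Binary.PropositionalEquality using (_≡_; refl)
open import Relation.Nullary using (¬_)
open import Function.Bundles using (_⇔_; mk⇔)

-- The P-positions (1, c) and (x, y, 1) with y > 1 are checked by hand; every
-- other three-heap position with a front heap above 1 has a move into one of
-- them, removing the front heap or rotating it to a new last heap 1.

isP⇒¬isN : ∀ {L} → IsP L → ¬ IsN L
isP⇒¬isN (allLose f) (winMove m p) = isP⇒¬isN p (f m)

[]-isP : IsP []
[]-isP = allLose λ ()

[c]-isN : ∀ c → IsN (c ∷ [])
[c]-isN c = winMove (remove c []) []-isP

[1,c]-isP : ∀ c → IsP (1 ∷ c ∷ [])
[1,c]-isP c = allLose λ where
  (remove _ _)                 → [c]-isN c
  (rotate _ _ _ () (s≤s z≤n))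

[x,y,1]-isP : ∀ x {y} → 1 < y → IsP (x ∷ y ∷ 1 ∷ [])
[x,y,1]-isP x {y} 1<y = allLose λ where
  (remove _ _)       → winMove (rotate y _ 1 ≤-refl 1<y) ([1,c]-isP 1)
  (rotate _ _ c _ _) → winMove (remove y _) ([1,c]-isP c)

[x,1,z]-isN : ∀ x z → IsN (x ∷ 1 ∷ z ∷ [])
[x,1,z]-isN x z = winMove (remove x _) ([1,c]-isP z)

[x,y,z]-isN : ∀ {x} y {z} → 1 < x → 1 < z → IsN (x ∷ y ∷ z ∷ [])
[x,y,z]-isN {x} y 1<x 1<z = winMove (rotate x _ 1 ≤-refl 1<x) ([x,y,1]-isP y 1<z)

isP-[x,y,z]⇒1<y×z≡1 : ∀ {x y z} → 1 < x → 1 ≤ y → 1 ≤ z →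
                       IsP (x ∷ y ∷ z ∷ []) → 1 < y × z ≡ 1
isP-[x,y,z]⇒1<y×z≡1 {x} {y} {z} 1<x 1≤y 1≤z p
  with m≤n⇒m<n∨m≡n 1≤y | m≤n⇒m<n∨m≡n 1≤z
... | inj₂ refl | _         = ⊥-elim (isP⇒¬isN p ([x,1,z]-isN x z))
... | inj₁ 1<y  | inj₂ refl = 1<y , refl
... | inj₁ 1<y  | inj₁ 1<z  = ⊥-elim (isP⇒¬isN p ([x,y,z]-isN y 1<x 1<z))

mainTheorem9 : (a₀ a₁ a₂ : ℕ) → 1 < a₀ → 1 ≤ a₁ → 1 ≤ a₂ →
    IsP (a₀ ∷ a₁ ∷ a₂ ∷ []) ⇔ (1 < a₁ × a₂ ≡ 1)
mainTheorem9 a₀ a₁ a₂ 1<a₀ 1≤a₁ 1≤a₂ =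
  mk⇔ (isP-[x,y,z]⇒1<y×z≡1 1<a₀ 1≤a₁ 1≤a₂) λ where
    (1<a₁ , refl) → [x,y,1]-isP a₀ 1<a₁
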